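{- Let $(e_i\mid i\in\omega)$ be a sequence of events with $e_i<_0 e_j\iff i<j$, with predicates $\mathrm{Add},\mathrm{Rem},\mathrm{Cnt}$ and functions $\mathrm{val},\chi$ as in the context. Then: (1) If there is a sequence of finite sets $(D_i\mid i\in\omega)$, $D_i\subseteq\mathbb N$, witnessing the state-based specification (i.e. $D_0=\emptyset$ and every triple $(D_i,e_i,D_{i+1})$ is correct), then there is a function $\gamma$ defined on the $\mathrm{Op}^1$ events of the sequence which satisfies FS0, FS1 and FS2. (2) If there is a function $\gamma$ on the $\mathrm{Op}^1$ events of the sequence which satisfies FS0, FS1 and FS2, then there is a sequence $(D_i\mid i\in\omega)$ of finite subsets of $\mathbb N$ with $D_0=\emptyset$ such that every triple $(D_i,e_i,D_{i+1})$ is correct.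
   Context: Setting. Three unary predicates $\mathrm{Add},\mathrm{Rem},\mathrm{Cnt}$ partition the events $e_i$. Each event $a$ has a key $\mathrm{val}(a)\in\mathbb N$ and a status $\chi(a)\in\{0,1,f\}$, where $\chi(a)\in\{0,1\}$ whenever $\mathrm{Cnt}(a)$. Shorthands: $\mathrm{Add}^p(a):\equiv\mathrm{Add}(a)\wedge\chi(a)=p$, $\mathrm{Rem}^p(a):\equiv\mathrm{Rem}(a)\wedge\chi(a)=p$ ($p\in\{0,1,f\}$), $\mathrm{Cnt}^p(a):\equiv \mathrm{Cnt}(a)\wedge\chi(a)=p$ and $\mathrm{Op}^p(a):\equiv(\mathrm{Add}(a)\vee\mathrm{Rem}(a)\vee\mathrm{Cnt}(a))\wedge\chi(a)=p$ ($p\in\{0,1\}$). Correct triples: for finite $D,D'\subseteq\mathbb N$ and an event $a$ with $x=\mathrm{val}(a)$, the triple $(D,a,D')$ is correct if: when $\mathrm{Add}^0(a)$: $x\notin D$ and $D'=D\cup\{x\}$; when $\mathrm{Add}^1(a)$: $x\in D$ and $D'=D$; when $\mathrm{Rem}^0(a)$: $x\notin D$ and $D'=D$; when $\mathrm{Rem}^1(a)$: $x\in D$ and $D'=D\setminus\{x\}$; when $\mathrm{Cnt}^0(a)$: $x\notin D$ and $D'=D$; when $\mathrm{Cnt}^1(a)$: $x\in D$ and $D'=D$; when $\chi(a)=f$ (then $a$ is an Add or Rem event): $D'=D$, with no condition on $x$. Functional specification for a function $\gamma$: FS0: $<_0$ is a linear ordering; $\mathrm{Add},\mathrm{Rem},\mathrm{Cnt}$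 are pairwise disjoint; $\gamma$ is defined on the $\mathrm{Op}^1$ events and takes $\mathrm{Add}^0$ events as values. FS1: for every event $a$ with $\mathrm{Op}^1(a)$: $\gamma(a)<_0 a$, $\mathrm{Add}^0(\gamma(a))$, $\mathrm{val}(a)=\mathrm{val}(\gamma(a))$, and there is no $r$ with $\mathrm{Rem}^1(r)$, $\gamma(r)=\gamma(a)$ and $\gamma(a)<_0r<_0a$. FS2: for all events $a<_0 b$ with $\mathrm{Add}^0(a)$, $\mathrm{Op}^0(b)$, $\mathrm{val}(a)=\mathrm{val}(b)$, there is $r$ with $a<_0 r<_0 b$, $\mathrm{Rem}^1(r)$ and $a=\gamma(r)$. -}

module Defs where

open import Data.Nat using (ℕ; suc; _<_)
open import Data.List using (List)
open import Data.List.Membership.Propositional using (_∈_; _∉_)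
open import Data.Product using (Σ; ∃; _×_)
open import Data.Sum using (_⊎_)
open import Relation.Nullary using (¬_)
open import Relation.Binary.PropositionalEquality using (_≡_; _≢_)

data Kind : Set where
  add rem cnt : Kind

data Status : Set where
  s0 s1 sf : Status

-- An ω-sequence of events e_i, identified with their index i; e_i <_0 e_j iff i < j.
record Events : Set where
  field
    kind : ℕ → Kind
    val  : ℕ → ℕ
    χ    : ℕ → Status
    cnt-status : ∀ i → kind i ≡ cnt → χ i ≢ sf
open Events public

module _ (E : Events) where
  Add Rem Cnt : ℕ → Set
  Add a = kind E a ≡ add
  Rem a = kind E a ≡ rem
  Cnt a = kind E a ≡ cnt

  Add^ Rem^ Cnt^ Op^ : Status → ℕ → Set
  Add^ p a = Add a × χ E a ≡ p
  Rem^ p a = Rem a × χ E a ≡ p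
  Cnt^ p a = Cnt a × χ E a ≡ p
  Op^  p a = (Add a ⊎ Rem a ⊎ Cnt a) × χ E a ≡ p

-- Finite subsets of ℕ are represented by lists, compared extensionally.
Empty : List ℕ → Set
Empty D = ∀ y → y ∉ D

SameSet : List ℕ → List ℕ → Set
SameSet D D' = ∀ y → (y ∈ D' → y ∈ D) × (y ∈ D → y ∈ D')

IsInsert : ℕ → List ℕ → List ℕ → Set
IsInsert x D D' = ∀ y → (y ∈ D' → y ∈ D ⊎ y ≡ x) × (y ∈ D ⊎ y ≡ x → y ∈ D')

IsRemove : ℕ → List ℕ → List ℕ → Set
IsRemove x D D' = ∀ y → (y ∈ D' → y ∈ D × y ≢ x) × (y ∈ D × y ≢ x → y ∈ D')

CorrectKS : Kind → Status → ℕ → List ℕ → List ℕ → Set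
CorrectKS add s0 x D D' = x ∉ D × IsInsert x D D'
CorrectKS add s1 x D D' = x ∈ D × SameSet D D'
CorrectKS rem s0 x D D' = x ∉ D × SameSet D D'
CorrectKS rem s1 x D D' = x ∈ D × IsRemove x D D'
CorrectKS cnt s0 x D D' = x ∉ D × SameSet D D'
CorrectKS cnt s1 x D D' = x ∈ D × SameSet D D'
CorrectKS _   sf x D D' = SameSet D D'

Correct : Events → List ℕ → ℕ → List ℕ → Set
Correct E D a D' = CorrectKS (kind E a) (χ E a) (val E a) D D'

StateSpec : Events → Set
StateSpec E = Σ (ℕ → List ℕ) λ D → Empty (D 0) × (∀ i → Correct E (D i) i (D (suc i)))

-- FS0 (γ on Op¹ events with Add⁰ values; the order/disjointness parts hold by construction),
-- FS1 and FS2 for a function γ (only its values on Op¹ events matter).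
FS0 FS1 FS2 FS : (E : Events) → (ℕ → ℕ) → Set
FS0 E γ = ∀ a → Op^ E s1 a → Add^ E s0 (γ a)
FS1 E γ = ∀ a → Op^ E s1 a →
  γ a < a × Add^ E s0 (γ a) × val E a ≡ val E (γ a) ×
  ¬ (∃ λ r → Rem^ E s1 r × γ r ≡ γ a × γ a < r × r < a)
FS2 E γ = ∀ a b → a < b → Add^ E s0 a → Op^ E s0 b → val E a ≡ val E b →
  ∃ λ r → a < r × r < b × Rem^ E s1 r × a ≡ γ r
FS E γ = FS0 E γ × FS1 E γ × FS2 E γ

-- (1) Given the states D_i, let γ(a) be the last Add⁰ event of val(a) before a. Since
-- val(a) ∈ D_a for an Op¹ event a, such an event exists, and a Rem¹ event r between
-- γ(a) and a with the same γ would remove val(a), forcing a later Add⁰ of it. For FS2,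
-- val(a) is inserted at a and absent at b, so it is removed in between; the first
-- such removal r has γ(r) = a, because an Add⁰ of val(a) in between would find it
-- already present.
--
-- (2) Given γ, take D_i to be the state obtained by running the updates. The invariant
-- is that x ∈ D_i iff some Add⁰ event b < i of x is still alive at i, i.e. no Rem¹
-- event r with γ(r) = b lies between b and i. By FS2 two alive Add⁰ events of the same
-- value coincide, which gives both the preconditions and the correctness of deletions.
module Submission where

open import Defs
open import Data.Nat using (ℕ; zero; suc; _<_; _≤_; _≟_; _≤‴_; ≤‴-refl; ≤‴-step; z≤n)
open import Data.Nat.Properties
  using (≤-refl; ≤-trans; ≤-antisym; <-trans; <⇒≤; <⇒≱; <-asym; <-cmp; ≤-pred;
         n<1+n; m<n⇒m<1+n; m<1+n⇒m<n∨m≡n; m≤n⇒m<n∨m≡n; ≤⇒≤‴; ≤‴⇒≤)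
open import Data.List using (List; []; _∷_; filter)
open import Data.List.Membership.Propositional using (_∈_; _∉_)
open import Data.List.Membership.Propositional.Properties using (∈-filter⁺; ∈-filter⁻)
open import Data.List.Membership.DecPropositional _≟_ using (_∈?_)
open import Data.List.Relation.Unary.Any using (here; there)
open import Data.Product using (Σ; ∃; _×_; _,_; proj₁; proj₂)
open import Data.Sum using (_⊎_; inj₁; inj₂)
open import Data.Unit using (⊤; tt)
open import Relation.Nullary using (¬_; Dec; yes; no; ¬?; contradiction)
open import Relation.Nullary.Decidable using (_×-dec_; decidable-stable)
open import Relation.Unary using (Decidable)
open import Relation.Binary using (tri<; tri≈; tri>)
open import Relation.Binary.PropositionalEquality using (_≡_; _≢_; refl; sym; trans; cong; cong₂; subst)

data Update : Set where
  insert delete keep : Update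

update : Kind → Status → Update
update add s0 = insert
update rem s1 = delete
update _   _  = keep

update≡insert : ∀ k s → update k s ≡ insert → k ≡ add × s ≡ s0
update≡insert add s0 _ = refl , refl
update≡insert add s1 ()
update≡insert add sf ()
update≡insert rem s0 ()
update≡insert rem s1 ()
update≡insert rem sf ()
update≡insert cnt _  ()

update≡delete : ∀ k s → update k s ≡ delete → k ≡ rem × s ≡ s1
update≡delete add s0 ()
update≡delete add s1 ()
update≡delete add sf ()
update≡delete rem s0 ()
update≡delete rem s1 _ = refl , refl
update≡delete rem sf ()
update≡delete cnt _  ()

Pre : Status → ℕ → List ℕ → Set
Pre s0 x D = x ∉ D
Pre s1 x D = x ∈ D
Pre sf x D = ⊤

Effect : Update → ℕ → List ℕ → List ℕ → Set
Effect insert x = IsInsert x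
Effect delete x = IsRemove x
Effect keep   _ = SameSet

correct⇒pre : ∀ k s {x D D'} → CorrectKS k s x D D' → Pre s x D
correct⇒pre add s0 = proj₁
correct⇒pre add s1 = proj₁
correct⇒pre add sf = λ _ → tt
correct⇒pre rem s0 = proj₁
correct⇒pre rem s1 = proj₁
correct⇒pre rem sf = λ _ → tt
correct⇒pre cnt s0 = proj₁
correct⇒pre cnt s1 = proj₁
correct⇒pre cnt sf = λ _ → tt

correct⇒effect : ∀ k s {x D D'} → CorrectKS k s x D D' → Effect (update k s) x D D'
correct⇒effect add s0 = proj₂
correct⇒effect add s1 = proj₂
correct⇒effect add sf = λ c → c
correct⇒effect rem s0 = proj₂
correct⇒effect rem s1 = proj₂
correct⇒effect rem sf = λ c → c
correct⇒effect cnt s0 = proj₂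
correct⇒effect cnt s1 = proj₂
correct⇒effect cnt sf = λ c → c

pre×effect⇒correct : ∀ k s {x D D'} → Pre s x D → Effect (update k s) x D D' → CorrectKS k s x D D'
pre×effect⇒correct add s0 p e = p , e
pre×effect⇒correct add s1 p e = p , e
pre×effect⇒correct add sf p e = e
pre×effect⇒correct rem s0 p e = p , e
pre×effect⇒correct rem s1 p e = p , e
pre×effect⇒correct rem sf p e = e
pre×effect⇒correct cnt s0 p e = p , e
pre×effect⇒correct cnt s1 p e = p , e
pre×effect⇒correct cnt sf p e = e

module _ {x : ℕ} {D D' : List ℕ} where

  effect-⊆ : ∀ u {y} → Effect u x D D' → y ∈ D' → y ∈ D ⊎ (u ≡ insert × y ≡ x)
  effect-⊆ insert e y∈ with proj₁ (e _) y∈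
  ... | inj₁ y∈D = inj₁ y∈D
  ... | inj₂ y≡x = inj₂ (refl , y≡x)
  effect-⊆ delete e y∈ = inj₁ (proj₁ (proj₁ (e _) y∈))
  effect-⊆ keep   e y∈ = inj₁ (proj₁ (e _) y∈)

  effect-keeps : ∀ u {y} → Effect u x D D' → y ∈ D → (u ≡ delete → y ≢ x) → y ∈ D'
  effect-keeps insert e y∈ _   = proj₂ (e _) (inj₁ y∈)
  effect-keeps delete e y∈ y≢x = proj₂ (e _) (y∈ , y≢x refl)
  effect-keeps keep   e y∈ _   = proj₂ (e _) y∈

  effect-drops : ∀ u {y} → Effect u x D D' → y ∈ D → y ∉ D' → u ≡ delete × y ≡ x
  effect-drops delete {y} e y∈ y∉ with y ≟ x
  ... | yes y≡x = refl , y≡x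
  ... | no  y≢x = contradiction (proj₂ (e y) (y∈ , y≢x)) y∉
  effect-drops insert e y∈ y∉ = contradiction (effect-keeps insert e y∈ λ ()) y∉
  effect-drops keep   e y∈ y∉ = contradiction (effect-keeps keep e y∈ λ ()) y∉

  delete-∉ : Effect delete x D D' → x ∉ D'
  delete-∉ e x∈ = proj₂ (proj₁ (e x) x∈) refl

  delete-≢ : ∀ {y} → Effect delete x D D' → y ∈ D' → y ≢ x
  delete-≢ e y∈ = proj₂ (proj₁ (e _) y∈)

  insert-∈ : Effect insert x D D' → x ∈ D'
  insert-∈ e = proj₂ (e x) (inj₂ refl)

apply : Update → ℕ → List ℕ → List ℕ
apply insert x D = x ∷ D
apply delete x D = filter (λ y → ¬? (y ≟ x)) D
apply keep   x D = D

apply-effect : ∀ u x D → Effect u x D (apply u x D)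
apply-effect insert x D y = (λ { (here y≡x) → inj₂ y≡x ; (there y∈) → inj₁ y∈ })
                          , (λ { (inj₁ y∈) → there y∈ ; (inj₂ y≡x) → here y≡x })
apply-effect delete x D y = ∈-filter⁻ (λ z → ¬? (z ≟ x))
                          , λ (y∈ , y≢x) → ∈-filter⁺ (λ z → ¬? (z ≟ x)) y∈ y≢x
apply-effect keep   x D y = (λ y∈ → y∈) , (λ y∈ → y∈)

module _ {P : ℕ → Set} (P? : Decidable P) where

  lastBelow : ℕ → ℕ
  lastBelow zero = zero
  lastBelow (suc n) with P? n
  ... | yes _ = n
  ... | no  _ = lastBelow n

  lastBelow-satisfies : ∀ {b i} → b < i → P b → lastBelow i < i × P (lastBelow i)
  lastBelow-satisfies {b} {suc n} b<1+n Pb with P? n | m<1+n⇒m<n∨m≡n b<1+n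
  ... | yes Pn | _         = n<1+n n , Pn
  ... | no ¬Pn | inj₂ refl = contradiction Pb ¬Pn
  ... | no ¬Pn | inj₁ b<n  with lastBelow-satisfies b<n Pb
  ...   | l<n , Pl = m<n⇒m<1+n l<n , Pl

  lastBelow-maximal : ∀ {c i} → c < i → P c → c ≤ lastBelow i
  lastBelow-maximal {c} {suc n} c<1+n Pc with P? n | m<1+n⇒m<n∨m≡n c<1+n
  ... | yes _  | _         = ≤-pred c<1+n
  ... | no ¬Pn | inj₂ refl = contradiction Pc ¬Pn
  ... | no ¬Pn | inj₁ c<n  = lastBelow-maximal c<n Pc

  first-exit : ∀ {j i} → j ≤ i → P j → ¬ P i →
    ∃ λ k → j ≤ k × k < i × (∀ m → j ≤ m → m ≤ k → P m) × ¬ P (suc k)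
  first-exit j≤i = go (≤⇒≤‴ j≤i)
    where
    go : ∀ {j i} → j ≤‴ i → P j → ¬ P i →
      ∃ λ k → j ≤ k × k < i × (∀ m → j ≤ m → m ≤ k → P m) × ¬ P (suc k)
    go ≤‴-refl Pj ¬Pi = contradiction Pj ¬Pi
    go {j} (≤‴-step 1+j≤i) Pj ¬Pi with P? (suc j)
    ... | no ¬P1+j = j , ≤-refl , ≤‴⇒≤ 1+j≤i , (λ m j≤m m≤j → subst P (≤-antisym j≤m m≤j) Pj) , ¬P1+j
    ... | yes P1+j with go 1+j≤i P1+j ¬Pi
    ...   | k , 1+j≤k , k<i , run , exit = k , <⇒≤ 1+j≤k , k<i , run′ , exit
      where
      run′ : ∀ m → j ≤ m → m ≤ k → P m
      run′ m j≤m m≤k with m≤n⇒m<n∨m≡n j≤m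
      ... | inj₁ j<m  = run m j<m m≤k
      ... | inj₂ refl = Pj

module _ (E : Events) where

  Adds : ℕ → ℕ → Set
  Adds x b = Add^ E s0 b × val E b ≡ x

  adds? : ∀ x → Decidable (Adds x)
  adds? x b = (is-add (kind E b) ×-dec is-s0 (χ E b)) ×-dec (val E b ≟ x)
    where
    is-add : ∀ k → Dec (k ≡ add)
    is-add add = yes refl
    is-add rem = no λ ()
    is-add cnt = no λ ()
    is-s0 : ∀ s → Dec (s ≡ s0)
    is-s0 s0 = yes refl
    is-s0 s1 = no λ ()
    is-s0 sf = no λ ()

  op-of-status : ∀ {p a} → χ E a ≡ p → Op^ E p a
  op-of-status {a = a} χa≡p = kind-cases (kind E a) , χa≡p
    where
    kind-cases : ∀ k → k ≡ add ⊎ k ≡ rem ⊎ k ≡ cnt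
    kind-cases add = inj₁ refl
    kind-cases rem = inj₂ (inj₁ refl)
    kind-cases cnt = inj₂ (inj₂ refl)

  -- The last conjunct of FS1 says exactly that γ(a) is alive at a.
  Alive : (ℕ → ℕ) → ℕ → ℕ → Set
  Alive γ b i = ¬ (∃ λ r → Rem^ E s1 r × γ r ≡ b × b < r × r < i)

  alive-pred : ∀ {γ b i} → Alive γ b (suc i) → Alive γ b i
  alive-pred alive (r , rem¹ , γr≡b , b<r , r<i) = alive (r , rem¹ , γr≡b , b<r , m<n⇒m<1+n r<i)

module StateToFunctional (E : Events) (D : ℕ → List ℕ) (D₀-empty : Empty (D 0))
                         (correct : ∀ i → Correct E (D i) i (D (suc i))) where

  pre : ∀ i → Pre (χ E i) (val E i) (D i)
  pre i = correct⇒pre (kind E i) (χ E i) (correct i)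

  effect : ∀ i → Effect (update (kind E i) (χ E i)) (val E i) (D i) (D (suc i))
  effect i = correct⇒effect (kind E i) (χ E i) (correct i)

  effect-as : ∀ {i u} → update (kind E i) (χ E i) ≡ u → Effect u (val E i) (D i) (D (suc i))
  effect-as {i} eq = subst (λ u → Effect u (val E i) (D i) (D (suc i))) eq (effect i)

  present : ∀ {i} → χ E i ≡ s1 → val E i ∈ D i
  present {i} χi≡1 = subst (λ s → Pre s (val E i) (D i)) χi≡1 (pre i)

  absent : ∀ {i} → χ E i ≡ s0 → val E i ∉ D i
  absent {i} χi≡0 = subst (λ s → Pre s (val E i) (D i)) χi≡0 (pre i)

  inserted : ∀ {i} → Add^ E s0 i → val E i ∈ D (suc i)
  inserted (k≡add , χi≡0) = insert-∈ (effect-as (cong₂ update k≡add χi≡0))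

  deleted : ∀ {i} → Rem^ E s1 i → val E i ∉ D (suc i)
  deleted (k≡rem , χi≡1) = delete-∉ (effect-as (cong₂ update k≡rem χi≡1))

  added-at : ∀ {x k} → x ∉ D k → x ∈ D (suc k) → Adds E x k
  added-at {k = k} x∉ x∈ with effect-⊆ _ (effect k) x∈
  ... | inj₁ x∈D        = contradiction x∈D x∉
  ... | inj₂ (u≡ins , x≡v) = update≡insert (kind E k) (χ E k) u≡ins , sym x≡v

  removed-at : ∀ {x k} → x ∈ D k → x ∉ D (suc k) → Rem^ E s1 k × val E k ≡ x
  removed-at {k = k} x∈ x∉ with effect-drops _ (effect k) x∈ x∉
  ... | u≡del , x≡v = update≡delete (kind E k) (χ E k) u≡del , sym x≡v

  added-between : ∀ {x j i} → j ≤ i → x ∉ D j → x ∈ D i → ∃ λ c → j ≤ c × c < i × Adds E x c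
  added-between {x} j≤i x∉ x∈ with first-exit (λ m → ¬? (x ∈? D m)) j≤i x∉ (λ x∉Di → x∉Di x∈)
  ... | c , j≤c , c<i , out , ¬out =
    c , j≤c , c<i , added-at (out c j≤c ≤-refl) (decidable-stable (x ∈? D (suc c)) ¬out)

  added-before : ∀ {x i} → x ∈ D i → ∃ λ b → b < i × Adds E x b
  added-before x∈ with added-between z≤n (D₀-empty _) x∈
  ... | b , _ , b<i , adds = b , b<i , adds

  γ : ℕ → ℕ
  γ a = lastBelow (adds? E (val E a)) a

  γ-maximal : ∀ {a c} → c < a → Adds E (val E a) c → c ≤ γ a
  γ-maximal = lastBelow-maximal (adds? E _)

  γ-adds : ∀ {a} → χ E a ≡ s1 → γ a < a × Adds E (val E a) (γ a)
  γ-adds χa≡1 with added-before (present χa≡1)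
  ... | b , b<a , adds = lastBelow-satisfies (adds? E _) b<a adds

  fs1 : FS1 E γ
  fs1 a (_ , χa≡1) with γ-adds χa≡1
  ... | γa<a , add⁰ , va≡ = γa<a , add⁰ , sym va≡ , alive
    where
    vr≡va : ∀ {r} → Rem^ E s1 r → γ r ≡ γ a → val E r ≡ val E a
    vr≡va rem¹ γr≡γa = trans (sym (proj₂ (proj₂ (γ-adds (proj₂ rem¹))))) (trans (cong (val E) γr≡γa) va≡)

    alive : Alive E γ (γ a) a
    alive (r , rem¹ , γr≡γa , γa<r , r<a)
      with added-between r<a (subst (_∉ D (suc r)) (vr≡va rem¹ γr≡γa) (deleted rem¹)) (present χa≡1)
    ... | c , r<c , c<a , adds = <-asym γa<r (≤-trans r<c (γ-maximal c<a adds))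

  fs0 : FS0 E γ
  fs0 a op = proj₁ (proj₂ (fs1 a op))

  fs2 : FS2 E γ
  fs2 a b a<b add⁰ (_ , χb≡0) va≡vb
    with first-exit (λ m → val E a ∈? D m) a<b (inserted add⁰) (subst (_∉ D b) (sym va≡vb) (absent χb≡0))
  ... | k , a<k , k<b , run , exit with removed-at (run k a<k ≤-refl) exit
  ...   | rem¹ , vk≡va = k , a<k , k<b , rem¹ , a≡γk
    where
    a≤γk : a ≤ γ k
    a≤γk = γ-maximal a<k (add⁰ , sym vk≡va)
    a≡γk : a ≡ γ k
    a≡γk with m≤n⇒m<n∨m≡n a≤γk | γ-adds (proj₂ rem¹)
    ... | inj₂ a≡γk | _                         = a≡γk
    ... | inj₁ a<γk | γk<k , (_ , χγk≡0) , vγk≡vk =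
      contradiction (subst (_∈ D (γ k)) (sym (trans vγk≡vk vk≡va)) (run (γ k) a<γk (<⇒≤ γk<k))) (absent χγk≡0)

module FunctionalToState (E : Events) (γ : ℕ → ℕ) (fs1 : FS1 E γ) (fs2 : FS2 E γ) where

  D : ℕ → List ℕ
  D zero    = []
  D (suc i) = apply (update (kind E i) (χ E i)) (val E i) (D i)

  effect : ∀ i → Effect (update (kind E i) (χ E i)) (val E i) (D i) (D (suc i))
  effect i = apply-effect (update (kind E i) (χ E i)) (val E i) (D i)

  separating-removal : ∀ {x c c′ i} → c < c′ → c′ < i → Adds E x c → Adds E x c′ →
                       ∃ λ r → Rem^ E s1 r × γ r ≡ c × c < r × r < i
  separating-removal c<c′ c′<i (add⁰ , vc) (add⁰′ , vc′)
    with fs2 _ _ c<c′ add⁰ (op-of-status E (proj₂ add⁰′)) (trans vc (sym vc′))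
  ... | r , c<r , r<c′ , rem¹ , c≡γr = r , rem¹ , sym c≡γr , c<r , <-trans r<c′ c′<i

  alive-unique : ∀ {x b b′ i} → b < i → b′ < i → Adds E x b → Adds E x b′ →
                 Alive E γ b i → Alive E γ b′ i → b ≡ b′
  alive-unique {b = b} {b′} b<i b′<i adds adds′ alive alive′ with <-cmp b b′
  ... | tri≈ _ b≡b′ _ = b≡b′
  ... | tri< b<b′ _ _ = contradiction (separating-removal b<b′ b′<i adds adds′) alive
  ... | tri> _ _ b′<b = contradiction (separating-removal b′<b b<i adds′ adds) alive′

  effect-as : ∀ {i u} → update (kind E i) (χ E i) ≡ u → Effect u (val E i) (D i) (D (suc i))
  effect-as {i} eq = subst (λ u → Effect u (val E i) (D i) (D (suc i))) eq (effect i)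

  alive-add-of : ∀ {y i} → y ∈ D i → ∃ λ b → b < i × Adds E y b × Alive E γ b i
  alive-add-of {y} {suc i} y∈ with effect-⊆ _ (effect i) y∈
  ... | inj₂ (u≡ins , y≡vi) = i , n<1+n i , (update≡insert (kind E i) (χ E i) u≡ins , sym y≡vi) , fresh
    where
    fresh : Alive E γ i (suc i)
    fresh (r , _ , _ , i<r , r<1+i) = <⇒≱ i<r (≤-pred r<1+i)
  ... | inj₁ y∈Di with alive-add-of y∈Di
  ...   | b , b<i , (add⁰ , vb≡y) , alive = b , m<n⇒m<1+n b<i , (add⁰ , vb≡y) , alive′
    where
    alive′ : Alive E γ b (suc i)
    alive′ (r , rem¹ , γr≡b , b<r , r<1+i) with m<1+n⇒m<n∨m≡n r<1+i
    ... | inj₁ r<i  = alive (r , rem¹ , γr≡b , b<r , r<i)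
    ... | inj₂ refl with fs1 i (op-of-status E (proj₂ rem¹))
    ...   | _ , _ , vi≡vγi , _ =
      delete-≢ (effect-as (cong₂ update (proj₁ rem¹) (proj₂ rem¹))) y∈
               (trans (sym vb≡y) (trans (cong (val E) (sym γr≡b)) (sym vi≡vγi)))

  alive-add-∈ : ∀ {b i} → b < i → Add^ E s0 b → Alive E γ b i → val E b ∈ D i
  alive-add-∈ {b} {suc i} b<1+i add⁰ alive with m<1+n⇒m<n∨m≡n b<1+i
  ... | inj₂ refl = insert-∈ (effect-as (cong₂ update (proj₁ add⁰) (proj₂ add⁰)))
  ... | inj₁ b<i  = effect-keeps _ (effect i) (alive-add-∈ b<i add⁰ (alive-pred E alive)) not-deleted
    where
    not-deleted : update (kind E i) (χ E i) ≡ delete → val E b ≢ val E i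
    not-deleted u≡del vb≡vi with update≡delete (kind E i) (χ E i) u≡del
    ... | rem¹ with fs1 i (op-of-status E (proj₂ rem¹))
    ...   | γi<i , add⁰′ , vi≡vγi , alive′ = alive (i , rem¹ , sym b≡γi , b<i , n<1+n i)
      where
      b≡γi : b ≡ γ i
      b≡γi = alive-unique b<i γi<i (add⁰ , trans vb≡vi vi≡vγi) (add⁰′ , refl) (alive-pred E alive) alive′

  present : ∀ {i} → χ E i ≡ s1 → val E i ∈ D i
  present {i} χi≡1 with fs1 i (op-of-status E χi≡1)
  ... | γi<i , add⁰ , vi≡vγi , alive = subst (_∈ D i) (sym vi≡vγi) (alive-add-∈ γi<i add⁰ alive)

  absent : ∀ {i} → χ E i ≡ s0 → val E i ∉ D i
  absent {i} χi≡0 vi∈ with alive-add-of vi∈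
  ... | b , b<i , (add⁰ , vb≡vi) , alive with fs2 b i b<i add⁰ (op-of-status E χi≡0) vb≡vi
  ...   | r , b<r , r<i , rem¹ , b≡γr = alive (r , rem¹ , sym b≡γr , b<r , r<i)

  pre : ∀ i → Pre (χ E i) (val E i) (D i)
  pre i with χ E i | present {i} | absent {i}
  ... | s0 | _     | vi∉ = vi∉ refl
  ... | s1 | vi∈   | _   = vi∈ refl
  ... | sf | _     | _   = tt

  correct : ∀ i → Correct E (D i) i (D (suc i))
  correct i = pre×effect⇒correct (kind E i) (χ E i) (pre i) (effect i)

theorem2p3 : (E : Events) →
    (StateSpec E → Σ (ℕ → ℕ) (λ γ → FS E γ)) ×
    (Σ (ℕ → ℕ) (λ γ → FS E γ) → StateSpec E)
theorem2p3 E = state⇒functional , functional⇒state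
  where
  state⇒functional : StateSpec E → Σ (ℕ → ℕ) (λ γ → FS E γ)
  state⇒functional (D , D₀-empty , correct) = γ , fs0 , fs1 , fs2
    where open StateToFunctional E D D₀-empty correct

  functional⇒state : Σ (ℕ → ℕ) (λ γ → FS E γ) → StateSpec E
  functional⇒state (γ , _ , fs1 , fs2) = D , (λ _ ()) , correct
    where open FunctionalToState E γ fs1 fs2
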